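{- Let $(H,k,\chi)$ be an instance of Precoloring Extension where $H$ has at least one edge, and let $G$ be the conflict graph constructed from it as described in the context. Then $tw(G)\le tw(H)+2$ and $pw(G)\le pw(H)+4$.
   Context: Precoloring Extension: given a graph $H=(V,F)$ with $V=\{1,\ldots,n\}$, an integer $k$, and a proper coloring $\chi:V_0\to\{1,\ldots,k\}$ of $H[V_0]$ for some $V_0\subseteq V$, decide whether there is a proper coloring $\chi':V\to\{1,\ldots,k\}$ of $H$ with $\chi'(v)=\chi(v)$ for all $v\in V_0$. Construction (jobs with processing times, and conflict graph $G$): start with $G=H$, with $p_j=1$ for each $j\in V$. Add four jobs $a,a',b,b'$ with $p_a=p_b=1$, $p_{a'}=p_{b'}=k-1$, and edges $\{a,a'\},\{b,b'\},\{a,b\}$. For each $j\in V_0$ with $\chi(j)\in\{2,\ldots,k-1\}$, add jobs $j(1),j(2)$ with $p_{j(1)}=\chi(j)-1$, $p_{j(2)}=k-\chi(j)$, and edges $\{j,j(1)\},\{j,j(2)\},\{j(1),j(2)\},\{a,j\},\{b,j\},\{a,j(2)\},\{b,j(1)\}$. For $j\in V_0$ with $\chi(j)=1$, add only $j(2)$ (with $p_{j(2)}=k-1$) and edges $\{j,j(2)\},\{b,j\},\{a,j(2)\}$ (no edge $\{a,j\}$). For $j\in V_0$ with $\chi(j)=k$, add only $j(1)$ (with $p_{j(1)}=k-1$) and edges $\{j,j(1)\},\{a,j\},\{b,j(1)\}$ (no edge $\{b,j\}$). $tw$ and $pw$ denote treewidth and pathwidth. -}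

module Defs where

open import Data.Nat using (ℕ; zero; suc; _+_; _≤_; _<_; _≡ᵇ_)
open import Data.Bool using (Bool; true; false; not; _∨_; T)
open import Data.Fin using (Fin; toℕ)
open import Data.Maybe using (Maybe; just; nothing)
open import Data.List using (List; length)
open import Data.List.Membership.Propositional using (_∈_)
open import Data.List.Relation.Unary.Unique.Propositional using (Unique)
open import Data.Product using (Σ; _×_; ∃; ∃-syntax)
open import Data.Sum using (_⊎_)
open import Data.Unit using (⊤)
open import Data.Empty using (⊥)
open import Relation.Binary.PropositionalEquality using (_≡_)

record Graph : Set₁ where
  field
    V : Set
    E : V → V → Set

record SimpleGraph (n : ℕ) : Set₁ where
  field
    E     : Fin n → Fin n → Set
    sym   : ∀ {u v} → E u v → E v u
    irrefl : ∀ {u} → E u u → ⊥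

toGraph : ∀ {n} → SimpleGraph n → Graph
toGraph {n} H = record { V = Fin n ; E = SimpleGraph.E H }

HasEdge : ∀ {n} → SimpleGraph n → Set
HasEdge {n} H = Σ (Fin n) λ u → Σ (Fin n) λ v → SimpleGraph.E H u v

data Walk {A : Set} (R : A → A → Set) (P : A → Set) : A → A → Set where
  here : ∀ {x} → P x → Walk R P x x
  step : ∀ {x y z} → P x → R x y → Walk R P y z → Walk R P x z

-- The tree has node set Fin m, edge list TE with
-- m = length TE + 1 and is connected (hence a tree, m ≥ 1).
-- Bags are duplicate-free lists, so length = cardinality.
-- Width ≤ w means every bag has at most w + 1 vertices.

record TreeDecomposition (G : Graph) (w : ℕ) : Set where
  open Graph G
  field
    m        : ℕ
    TE       : List (Fin m × Fin m)
    treeSize : m ≡ length TE + 1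
  TAdj : Fin m → Fin m → Set
  TAdj s t = (s Data.Product., t) ∈ TE ⊎ (t Data.Product., s) ∈ TE
  field
    treeConnected : ∀ s t → Walk TAdj (λ _ → ⊤) s t
    bag      : Fin m → List V
    bagUnique : ∀ t → Unique (bag t)
    bagWidth : ∀ t → length (bag t) ≤ suc w
    coverV   : ∀ v → ∃[ t ] (v ∈ bag t)
    coverE   : ∀ u v → E u v → ∃[ t ] (u ∈ bag t × v ∈ bag t)
    subtree  : ∀ v s t → v ∈ bag s → v ∈ bag t →
               Walk TAdj (λ r → v ∈ bag r) s t

TwLe : Graph → ℕ → Set
TwLe G w = TreeDecomposition G w

record PathDecomposition (G : Graph) (w : ℕ) : Set where
  open Graph G
  field
    m        : ℕ
    bag      : Fin (suc m) → List V
    bagUnique : ∀ t → Unique (bag t)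
    bagWidth : ∀ t → length (bag t) ≤ suc w
    coverV   : ∀ v → ∃[ t ] (v ∈ bag t)
    coverE   : ∀ u v → E u v → ∃[ t ] (u ∈ bag t × v ∈ bag t)
    interval : ∀ v (i j l : Fin (suc m)) → toℕ i ≤ toℕ j → toℕ j ≤ toℕ l →
               v ∈ bag i → v ∈ bag l → v ∈ bag j

PwLe : Graph → ℕ → Set
PwLe G w = PathDecomposition G w

-- Precoloring Extension instances.
-- χ : Fin n → Maybe ℕ ; χ j = nothing means j ∉ V₀, χ j = just c means
-- j ∈ V₀ with colour c.

ValidPrecoloring : ∀ {n} → SimpleGraph n → ℕ → (Fin n → Maybe ℕ) → Set
ValidPrecoloring {n} H k χ =
  (∀ j c → χ j ≡ just c → 1 ≤ c × c ≤ k) ×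
  (∀ u v c → SimpleGraph.E H u v → χ u ≡ just c → χ v ≡ just c → ⊥)

-- j(1) exists iff j ∈ V₀ and χ(j) ∈ {2..k}  (i.e. χ(j) ≠ 1)
has1 : ℕ → Maybe ℕ → Bool
has1 k nothing  = false
has1 k (just c) = not (c ≡ᵇ 1)

-- j(2) exists iff j ∈ V₀ and χ(j) ∈ {1..k-1}  (χ(j) = 1 or χ(j) ≠ k)
has2 : ℕ → Maybe ℕ → Bool
has2 k nothing  = false
has2 k (just c) = (c ≡ᵇ 1) ∨ not (c ≡ᵇ k)

data GV (n k : ℕ) (χ : Fin n → Maybe ℕ) : Set where
  orig : Fin n → GV n k χ
  a a' b b' : GV n k χ
  j1 : (j : Fin n) → T (has1 k (χ j)) → GV n k χ
  j2 : (j : Fin n) → T (has2 k (χ j)) → GV n k χ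

-- Generating edges (G is the symmetric closure).
--   middle colours 2..k-1 : j–j1, j–j2, j1–j2, a–j, b–j, a–j2, b–j1
--   colour 1              : j–j2, b–j, a–j2
--   colour k              : j–j1, a–j, b–j1
-- These are exactly the edges below, since a–j / j–j1 / b–j1 occur iff j(1)
-- exists and b–j / j–j2 / a–j2 occur iff j(2) exists.
data GE0 {n : ℕ} (H : SimpleGraph n) (k : ℕ) (χ : Fin n → Maybe ℕ) :
         GV n k χ → GV n k χ → Set where
  eH    : ∀ {u v} → SimpleGraph.E H u v → GE0 H k χ (orig u) (orig v)
  eaa'  : GE0 H k χ a a'
  ebb'  : GE0 H k χ b b'
  eab   : GE0 H k χ a b
  ej-j1 : ∀ j (p : T (has1 k (χ j))) → GE0 H k χ (orig j) (j1 j p)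
  ej-j2 : ∀ j (q : T (has2 k (χ j))) → GE0 H k χ (orig j) (j2 j q)
  ej1-j2 : ∀ j (p : T (has1 k (χ j))) (q : T (has2 k (χ j))) →
           GE0 H k χ (j1 j p) (j2 j q)
  ea-j  : ∀ j → T (has1 k (χ j)) → GE0 H k χ a (orig j)
  eb-j  : ∀ j → T (has2 k (χ j)) → GE0 H k χ b (orig j)
  ea-j2 : ∀ j (q : T (has2 k (χ j))) → GE0 H k χ a (j2 j q)
  eb-j1 : ∀ j (p : T (has1 k (χ j))) → GE0 H k χ b (j1 j p)

conflictGraph : ∀ {n} → SimpleGraph n → ℕ → (Fin n → Maybe ℕ) → Graph
conflictGraph {n} H k χ = record
  { V = GV n k χ
  ; E = λ x y → GE0 H k χ x y ⊎ GE0 H k χ y x }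

ptime : ∀ {n k χ} → GV n k χ → ℕ
ptime (orig j) = 1
ptime a = 1
ptime b = 1
ptime {k = k} a' = k Data.Nat.∸ 1
ptime {k = k} b' = k Data.Nat.∸ 1
ptime {k = k} {χ} (j1 j _) with χ j
... | just c  = c Data.Nat.∸ 1
... | nothing = 0
ptime {k = k} {χ} (j2 j _) with χ j
... | just c  = k Data.Nat.∸ c
... | nothing = 0

module Submission where

-- Both decompositions of G are obtained from one of H by adding a and b to every bag.
-- For the tree decomposition, hang the bags {a, a'} and {b, b'} off a root, and below a node
-- whose bag contains j a path of two bags {a, b, j, j(1)} and {a, j, j(1), j(2)}; as H has an
-- edge, its width w is at least 1, so these bags of size at most 4 fit into width w + 2.
-- For the path decomposition, start with the bag {a, a', b, b'} and repeat every bag X_t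
-- n times, the copy (t, j) also receiving j(1) and j(2) when X_t is the chosen bag of j;
-- this adds at most 4 vertices to a bag. Bags are built as lists with repetitions and
-- deduplicated at the end.

open import Defs
open import Data.Nat using (ℕ; zero; suc; _+_; _*_; _≤_; _<_; z≤n; s≤s; s≤s⁻¹; _<?_; NonZero)
  renaming (_≟_ to _≟ℕ_)
open import Data.Nat.Properties
open import Data.Nat.DivMod
open import Data.Nat.Divisibility using (n∣m*n)
open import Data.Bool using (Bool; true; false; T)
open import Data.Unit using (⊤; tt)
open import Data.Empty using (⊥-elim)
open import Data.Fin using (Fin; zero; suc; toℕ; fromℕ<)
open import Data.Fin.Properties using (toℕ-fromℕ<; fromℕ<-toℕ; toℕ-injective; toℕ<n; +↔⊎)
import Data.Fin.Properties as Fin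
open import Data.Maybe using (Maybe; just; nothing)
open import Data.Maybe.Properties using (just-injective)
open import Data.List using (List; []; _∷_; _++_; map; length; tabulate; deduplicate; head)
open import Data.List.Properties using (length-++; length-map; length-tabulate; length-deduplicate)
open import Data.List.Membership.Propositional using (_∈_)
open import Data.List.Membership.Propositional.Properties
  using (∈-map⁺; ∈-map⁻; ∈-++⁺ˡ; ∈-++⁺ʳ; ∈-++⁻; ∈-tabulate⁺)
  renaming (∈-deduplicate⁺ to ∈-dedup⁺; ∈-deduplicate⁻ to ∈-dedup⁻)
open import Data.List.Relation.Unary.Any using (here; there)
open import Data.List.Relation.Unary.Unique.DecPropositional.Properties using (deduplicate-!)
open import Data.Product using (Σ; _×_; _,_; proj₁; proj₂; ∃-syntax; map₂; uncurry)
import Data.Product.Properties as Product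
open import Data.Sum using (_⊎_; inj₁; inj₂)
import Data.Sum.Properties as Sum
open import Function.Bundles using (_↔_; mk↔ₛ′; Inverse)
open import Function.Construct.Composition using (_↔-∘_)
open import Function.Construct.Identity using (↔-id)
open import Function.Construct.Symmetry using (↔-sym)
open import Data.Sum.Function.Propositional using (_⊎-↔_)
open import Relation.Nullary using (yes; no)
open import Relation.Nullary.Decidable using (map′)
open import Relation.Binary.Definitions using (DecidableEquality)
open import Relation.Binary.PropositionalEquality

module _ {A : Set} {R : A → A → Set} {P : A → Set} where

  walk-source : ∀ {x y} → Walk R P x y → P x
  walk-source (here px)     = px
  walk-source (step px _ _) = px

  infixr 5 _◅◅_
  _◅◅_ : ∀ {x y z} → Walk R P x y → Walk R P y z → Walk R P x z
  here _       ◅◅ q = q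
  step px r p  ◅◅ q = step px r (p ◅◅ q)

  walk-reverse : (∀ {x y} → R x y → R y x) → ∀ {x y} → Walk R P x y → Walk R P y x
  walk-reverse sym (here px)       = here px
  walk-reverse sym (step px r p) = walk-reverse sym p ◅◅ step (walk-source p) (sym r) (here px)

walk-map : ∀ {A B : Set} {R : A → A → Set} {P : A → Set} {R′ : B → B → Set} {P′ : B → Set}
  (f : A → B) → (∀ {x y} → R x y → R′ (f x) (f y)) → (∀ {x} → P x → P′ (f x)) →
  ∀ {x y} → Walk R P x y → Walk R′ P′ (f x) (f y)
walk-map f g h (here px)     = here (h px)
walk-map f g h (step px r p) = step (h px) (g r) (walk-map f g h p)

distinct∈⇒2≤length : ∀ {X : Set} {x y : X} {xs} → x ∈ xs → y ∈ xs → x ≢ y → 2 ≤ length xs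
distinct∈⇒2≤length {xs = _ ∷ []}    (here refl) (here refl) x≢y = ⊥-elim (x≢y refl)
distinct∈⇒2≤length {xs = _ ∷ _ ∷ _} _           _           _   = s≤s (s≤s z≤n)

module _ {X : Set} where

  optional : (b : Bool) → (T b → X) → List X
  optional true  f = f tt ∷ []
  optional false f = []

  ∈-optional⁺ : ∀ b (f : T b → X) p → f p ∈ optional b f
  ∈-optional⁺ true f tt = here refl

  ∈-optional⁻ : ∀ b (f : T b → X) {x} → x ∈ optional b f → ∃[ p ] x ≡ f p
  ∈-optional⁻ true f (here x≡f) = tt , x≡f

  length-optional : ∀ b (f : T b → X) → length (optional b f) ≤ 1
  length-optional true  f = s≤s z≤n
  length-optional false f = z≤n

  head-optional : ∀ b (f : T b → X) p → head (optional b f) ≡ just (f p)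
  head-optional true f tt = refl

module _ {n : ℕ} .{{_ : NonZero n}} (q : ℕ) (r : Fin n) where

  [r+q*n]/n≡q : (toℕ r + q * n) / n ≡ q
  [r+q*n]/n≡q = begin
    (toℕ r + q * n) / n    ≡⟨ +-distrib-/-∣ʳ (toℕ r) (n∣m*n q) ⟩
    toℕ r / n + q * n / n  ≡⟨ cong₂ _+_ (m<n⇒m/n≡0 (toℕ<n r)) (m*n/n≡m q n) ⟩
    q                      ∎
    where open ≡-Reasoning

  [r+q*n]mod[n]≡r : (toℕ r + q * n) mod n ≡ r
  [r+q*n]mod[n]≡r = toℕ-injective (begin
    toℕ ((toℕ r + q * n) mod n)  ≡⟨ toℕ-fromℕ< (m%n<n (toℕ r + q * n) n) ⟩
    (toℕ r + q * n) % n          ≡⟨ [m+kn]%n≡m%n (toℕ r) q n ⟩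
    toℕ r % n                    ≡⟨ m<n⇒m%n≡m (toℕ<n r) ⟩
    toℕ r                        ∎)
    where open ≡-Reasoning

  r+q*n<s*n : ∀ {s} → q < s → toℕ r + q * n < s * n
  r+q*n<s*n q<s = ≤-trans (+-monoˡ-< (q * n) (toℕ<n r)) (*-monoˡ-≤ n q<s)

record MultiTreeDecomposition (G : Graph) (K : Set) (w : ℕ) : Set where
  open Graph G
  field
    m        : ℕ
    index    : K ↔ Fin m
    TE       : List (K × K)
    treeSize : m ≡ length TE + 1
  TAdj : K → K → Set
  TAdj s t = (s , t) ∈ TE ⊎ (t , s) ∈ TE
  field
    treeConnected : ∀ s t → Walk TAdj (λ _ → ⊤) s t
    bag      : K → List V
    bagWidth : ∀ t → length (bag t) ≤ suc w
    coverV   : ∀ v → ∃[ t ] (v ∈ bag t)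
    coverE   : ∀ u v → E u v → ∃[ t ] (u ∈ bag t × v ∈ bag t)
    subtree  : ∀ v s t → v ∈ bag s → v ∈ bag t → Walk TAdj (λ r → v ∈ bag r) s t

record MultiPathDecomposition (G : Graph) (w : ℕ) : Set where
  open Graph G
  field
    m        : ℕ
    bag      : ℕ → List V
    bagWidth : ∀ x → length (bag x) ≤ suc w
    coverV   : ∀ v → ∃[ x ] (x ≤ m × v ∈ bag x)
    coverE   : ∀ u v → E u v → ∃[ x ] (x ≤ m × u ∈ bag x × v ∈ bag x)
    interval : ∀ v {x y z} → x ≤ y → y ≤ z → v ∈ bag x → v ∈ bag z → v ∈ bag y

module _ {G : Graph} {w : ℕ} (_≟_ : DecidableEquality (Graph.V G)) where
  open Graph G using (V)

  toTreeDecomposition : ∀ {K} → MultiTreeDecomposition G K w → TreeDecomposition G w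
  toTreeDecomposition D = record
    { m             = m
    ; TE            = TE′
    ; treeSize      = trans treeSize (cong (_+ 1) (sym (length-map _ TE)))
    ; treeConnected = λ i j → transport (λ _ → tt) (treeConnected (from i) (from j))
    ; bag           = bag′
    ; bagUnique     = λ i → deduplicate-! _≟_ (bag (from i))
    ; bagWidth      = λ i → ≤-trans (length-deduplicate _≟_ (bag (from i))) (bagWidth (from i))
    ; coverV        = λ v → let (t , v∈t) = coverV v in to t , ∈-bag′⁺ v∈t
    ; coverE        = λ u v e → let (t , u∈t , v∈t) = coverE u v e in to t , ∈-bag′⁺ u∈t , ∈-bag′⁺ v∈t
    ; subtree       = λ v i j v∈i v∈j →
        transport ∈-bag′⁺ (subtree v (from i) (from j) (∈-dedup⁻ _≟_ _ v∈i) (∈-dedup⁻ _≟_ _ v∈j))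
    }
    where
    open MultiTreeDecomposition D
    open Inverse index using (to; from; strictlyInverseˡ; strictlyInverseʳ)

    TE′ : List (Fin m × Fin m)
    TE′ = map (λ (s , t) → to s , to t) TE

    TAdj′ : Fin m → Fin m → Set
    TAdj′ i j = (i , j) ∈ TE′ ⊎ (j , i) ∈ TE′

    bag′ : Fin m → List V
    bag′ i = deduplicate _≟_ (bag (from i))

    ∈-bag′⁺ : ∀ {v t} → v ∈ bag t → v ∈ bag′ (to t)
    ∈-bag′⁺ {v} {t} v∈t = ∈-dedup⁺ _≟_ (subst (λ r → v ∈ bag r) (sym (strictlyInverseʳ t)) v∈t)

    transport : ∀ {P : _ → Set} {P′ : Fin m → Set} → (∀ {r} → P r → P′ (to r)) →
                ∀ {i j} → Walk TAdj P (from i) (from j) → Walk TAdj′ P′ i j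
    transport {P′ = P′} h {i} {j} p =
      subst₂ (Walk TAdj′ P′) (strictlyInverseˡ i) (strictlyInverseˡ j) (walk-map to to-adj h p)
      where
      to-adj : ∀ {s t} → TAdj s t → TAdj′ (to s) (to t)
      to-adj (inj₁ st) = inj₁ (∈-map⁺ _ st)
      to-adj (inj₂ ts) = inj₂ (∈-map⁺ _ ts)

  toPathDecomposition : MultiPathDecomposition G w → PathDecomposition G w
  toPathDecomposition D = record
    { m         = m
    ; bag       = bag′
    ; bagUnique = λ i → deduplicate-! _≟_ (bag (toℕ i))
    ; bagWidth  = λ i → ≤-trans (length-deduplicate _≟_ (bag (toℕ i))) (bagWidth (toℕ i))
    ; coverV    = λ v → let (x , x≤m , v∈x) = coverV v in position x≤m , ∈-bag′⁺ x≤m v∈x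
    ; coverE    = λ u v e → let (x , x≤m , u∈x , v∈x) = coverE u v e in
                            position x≤m , ∈-bag′⁺ x≤m u∈x , ∈-bag′⁺ x≤m v∈x
    ; interval  = λ v i j l i≤j j≤l v∈i v∈l →
        ∈-dedup⁺ _≟_ (interval v i≤j j≤l (∈-dedup⁻ _≟_ _ v∈i) (∈-dedup⁻ _≟_ _ v∈l))
    }
    where
    open MultiPathDecomposition D

    bag′ : Fin (suc m) → List V
    bag′ i = deduplicate _≟_ (bag (toℕ i))

    position : ∀ {x} → x ≤ m → Fin (suc m)
    position x≤m = fromℕ< (s≤s x≤m)

    ∈-bag′⁺ : ∀ {v x} (x≤m : x ≤ m) → v ∈ bag x → v ∈ bag′ (position x≤m)
    ∈-bag′⁺ {v} x≤m v∈x = ∈-dedup⁺ _≟_ (subst (λ y → v ∈ bag y) (sym (toℕ-fromℕ< (s≤s x≤m))) v∈x)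

fromPathDecomposition : ∀ {G w} → PathDecomposition G w → MultiPathDecomposition G w
fromPathDecomposition {G} {w} D = record
  { m        = m
  ; bag      = bagℕ
  ; bagWidth = bagℕ-width
  ; coverV   = λ v → let (t , v∈t) = coverV v in toℕ t , toℕ≤m t , ∈-bagℕ⁺ v∈t
  ; coverE   = λ u v e → let (t , u∈t , v∈t) = coverE u v e in
                          toℕ t , toℕ≤m t , ∈-bagℕ⁺ u∈t , ∈-bagℕ⁺ v∈t
  ; interval = bagℕ-interval
  }
  where
  open Graph G using (V)
  open PathDecomposition D

  bagℕ : ℕ → List V
  bagℕ x with x <? suc m
  ... | yes x<m = bag (fromℕ< x<m)
  ... | no  _   = []

  bagℕ-width : ∀ x → length (bagℕ x) ≤ suc w
  bagℕ-width x with x <? suc m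
  ... | yes x<m = bagWidth (fromℕ< x<m)
  ... | no  _   = z≤n

  ∈-bagℕ⁻ : ∀ {v} x → v ∈ bagℕ x → Σ (x < suc m) λ x<m → v ∈ bag (fromℕ< x<m)
  ∈-bagℕ⁻ x v∈x with x <? suc m
  ... | yes x<m = x<m , v∈x

  ∈-bagℕ⁺′ : ∀ {v x} (x<m : x < suc m) → v ∈ bag (fromℕ< x<m) → v ∈ bagℕ x
  ∈-bagℕ⁺′ {x = x} x<m v∈x with x <? suc m
  ... | yes x<m′ = subst (λ t → _ ∈ bag t) (Fin.fromℕ<-cong x x refl x<m x<m′) v∈x
  ... | no  x≮m  = ⊥-elim (x≮m x<m)

  toℕ≤m : ∀ t → toℕ t ≤ m
  toℕ≤m t = s≤s⁻¹ (toℕ<n t)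

  ∈-bagℕ⁺ : ∀ {v t} → v ∈ bag t → v ∈ bagℕ (toℕ t)
  ∈-bagℕ⁺ {v} {t} v∈t = ∈-bagℕ⁺′ (toℕ<n t) (subst (λ r → v ∈ bag r) (sym (fromℕ<-toℕ t (toℕ<n t))) v∈t)

  ordered : ∀ {p q} (p<m : p < suc m) (q<m : q < suc m) → p ≤ q → toℕ (fromℕ< p<m) ≤ toℕ (fromℕ< q<m)
  ordered p<m q<m = subst₂ _≤_ (sym (toℕ-fromℕ< p<m)) (sym (toℕ-fromℕ< q<m))

  bagℕ-interval : ∀ v {x y z} → x ≤ y → y ≤ z → v ∈ bagℕ x → v ∈ bagℕ z → v ∈ bagℕ y
  bagℕ-interval v {x} {y} {z} x≤y y≤z v∈x v∈z =
    let (x<m , v∈x′) = ∈-bagℕ⁻ x v∈x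
        (z<m , v∈z′) = ∈-bagℕ⁻ z v∈z
        y<m          = ≤-<-trans y≤z z<m
    in ∈-bagℕ⁺′ y<m (interval v _ _ _ (ordered x<m y<m x≤y) (ordered y<m z<m y≤z) v∈x′ v∈z′)

edge⇒1≤width : ∀ {n w} (H : SimpleGraph n) → HasEdge H → TreeDecomposition (toGraph H) w → 1 ≤ w
edge⇒1≤width H (u , v , e) D =
  let (t , u∈t , v∈t) = coverE u v e
      u≢v u≡v = SimpleGraph.irrefl H (subst (SimpleGraph.E H u) (sym u≡v) e)
  in s≤s⁻¹ (≤-trans (distinct∈⇒2≤length u∈t v∈t u≢v) (bagWidth t))
  where open TreeDecomposition D

module _ {n k : ℕ} {χ : Fin n → Maybe ℕ} where

  gadget₁ : Fin n → List (GV n k χ)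
  gadget₁ j = optional (has1 k (χ j)) (j1 j)

  gadget₂ : Fin n → List (GV n k χ)
  gadget₂ j = optional (has2 k (χ j)) (j2 j)

  gadgets : Fin n → List (GV n k χ)
  gadgets j = gadget₁ j ++ gadget₂ j

  ∈-gadgets⁻ : ∀ {v} j → v ∈ gadgets j → (∃[ p ] v ≡ j1 j p) ⊎ (∃[ q ] v ≡ j2 j q)
  ∈-gadgets⁻ j v∈ with ∈-++⁻ (gadget₁ j) v∈
  ... | inj₁ v∈₁ = inj₁ (∈-optional⁻ _ _ v∈₁)
  ... | inj₂ v∈₂ = inj₂ (∈-optional⁻ _ _ v∈₂)

  j1∈gadgets : ∀ j p → j1 j p ∈ gadgets j
  j1∈gadgets j p = ∈-++⁺ˡ (∈-optional⁺ _ _ p)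

  j2∈gadgets : ∀ j q → j2 j q ∈ gadgets j
  j2∈gadgets j q = ∈-++⁺ʳ (gadget₁ j) (∈-optional⁺ _ _ q)

  length-gadgets : ∀ j → length (gadgets j) ≤ 2
  length-gadgets j = subst (_≤ 2) (sym (length-++ (gadget₁ j)))
    (+-mono-≤ (length-optional (has1 k (χ j)) (j1 j)) (length-optional (has2 k (χ j)) (j2 j)))

  private
    Code : Set
    Code = ℕ ⊎ (ℕ × Fin n)

    encode : GV n k χ → Code
    encode a         = inj₁ 0
    encode a'        = inj₁ 1
    encode b         = inj₁ 2
    encode b'        = inj₁ 3
    encode (orig j)  = inj₂ (0 , j)
    encode (j1 j _)  = inj₂ (1 , j)
    encode (j2 j _)  = inj₂ (2 , j)

    decode : Code → Maybe (GV n k χ)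
    decode (inj₁ 0)       = just a
    decode (inj₁ 1)       = just a'
    decode (inj₁ 2)       = just b
    decode (inj₁ 3)       = just b'
    decode (inj₂ (0 , j)) = just (orig j)
    decode (inj₂ (1 , j)) = head (gadget₁ j)
    decode (inj₂ (2 , j)) = head (gadget₂ j)
    decode _              = nothing

    decode-encode : ∀ v → decode (encode v) ≡ just v
    decode-encode a        = refl
    decode-encode a'       = refl
    decode-encode b        = refl
    decode-encode b'       = refl
    decode-encode (orig j) = refl
    decode-encode (j1 j p) = head-optional _ (j1 j) p
    decode-encode (j2 j q) = head-optional _ (j2 j) q

    encode-injective : ∀ {u v} → encode u ≡ encode v → u ≡ v
    encode-injective {u} {v} eq =
      just-injective (trans (sym (decode-encode u)) (trans (cong decode eq) (decode-encode v)))

    _≟ᶜ_ : DecidableEquality Code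
    _≟ᶜ_ = Sum.≡-dec _≟ℕ_ (Product.≡-dec _≟ℕ_ Fin._≟_)

  _≟ⱽ_ : DecidableEquality (GV n k χ)
  u ≟ⱽ v = map′ encode-injective (cong encode) (encode u ≟ᶜ encode v)

data Node (m n : ℕ) : Set where
  old          : Fin m → Node m n
  leafA leafB  : Node m n
  node₁ node₂  : Fin n → Node m n

node↔Fin : ∀ {m n} → Node m n ↔ Fin (m + (2 + (n + n)))
node↔Fin {m} {n} = ↔-sym sizes ↔-∘ mk↔ₛ′ to from to∘from from∘to
  where
  Parts : Set
  Parts = Fin m ⊎ (Fin 2 ⊎ (Fin n ⊎ Fin n))

  sizes : Fin (m + (2 + (n + n))) ↔ Parts
  sizes = (↔-id _ ⊎-↔ (↔-id _ ⊎-↔ +↔⊎)) ↔-∘ ((↔-id _ ⊎-↔ +↔⊎) ↔-∘ +↔⊎)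

  to : Node m n → Parts
  to (old t)   = inj₁ t
  to leafA     = inj₂ (inj₁ zero)
  to leafB     = inj₂ (inj₁ (suc zero))
  to (node₁ j) = inj₂ (inj₂ (inj₁ j))
  to (node₂ j) = inj₂ (inj₂ (inj₂ j))

  from : Parts → Node m n
  from (inj₁ t)                 = old t
  from (inj₂ (inj₁ zero))       = leafA
  from (inj₂ (inj₁ (suc zero))) = leafB
  from (inj₂ (inj₂ (inj₁ j)))   = node₁ j
  from (inj₂ (inj₂ (inj₂ j)))   = node₂ j

  to∘from : ∀ x → to (from x) ≡ x
  to∘from (inj₁ t)                 = refl
  to∘from (inj₂ (inj₁ zero))       = refl
  to∘from (inj₂ (inj₁ (suc zero))) = refl
  to∘from (inj₂ (inj₂ (inj₁ j)))   = refl
  to∘from (inj₂ (inj₂ (inj₂ j)))   = refl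

  from∘to : ∀ x → from (to x) ≡ x
  from∘to (old t)   = refl
  from∘to leafA     = refl
  from∘to leafB     = refl
  from∘to (node₁ j) = refl
  from∘to (node₂ j) = refl

module TreeConstruction {n} (H : SimpleGraph n) (k : ℕ) (χ : Fin n → Maybe ℕ) {w : ℕ}
                        (D : TreeDecomposition (toGraph H) w) where

  open TreeDecomposition D using () renaming
    (m to m₀; TE to TE₀; treeSize to treeSize₀; TAdj to TAdj₀; treeConnected to connected₀;
     bag to X; coverV to coverV₀; coverE to coverE₀; subtree to subtree₀)

  V : Set
  V = GV n k χ

  K : Set
  K = Node m₀ n

  home : Fin n → Fin m₀
  home j = proj₁ (coverV₀ j)

  j∈home : ∀ j → j ∈ X (home j)
  j∈home j = proj₂ (coverV₀ j)

  root : Fin m₀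
  root = subst Fin (sym (trans treeSize₀ (+-comm (length TE₀) 1))) zero

  homeEdges pairEdges TE : List (K × K)
  homeEdges = tabulate (λ j → old (home j) , node₁ j)
  pairEdges = tabulate (λ j → node₁ j , node₂ j)
  TE = map (λ (s , t) → old s , old t) TE₀ ++ (old root , leafA) ∷ (old root , leafB) ∷ homeEdges ++ pairEdges

  Adj : K → K → Set
  Adj s t = (s , t) ∈ TE ⊎ (t , s) ∈ TE

  Adj-sym : ∀ {s t} → Adj s t → Adj t s
  Adj-sym (inj₁ st) = inj₂ st
  Adj-sym (inj₂ ts) = inj₁ ts

  old-adj : ∀ {s t} → TAdj₀ s t → Adj (old s) (old t)
  old-adj (inj₁ st) = inj₁ (∈-++⁺ˡ (∈-map⁺ _ st))
  old-adj (inj₂ ts) = inj₂ (∈-++⁺ˡ (∈-map⁺ _ ts))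

  leafA→root : Adj leafA (old root)
  leafA→root = inj₂ (∈-++⁺ʳ _ (here refl))

  leafB→root : Adj leafB (old root)
  leafB→root = inj₂ (∈-++⁺ʳ _ (there (here refl)))

  node₁→home : ∀ j → Adj (node₁ j) (old (home j))
  node₁→home j = inj₂ (∈-++⁺ʳ _ (there (there (∈-++⁺ˡ (∈-tabulate⁺ j)))))

  node₂→node₁ : ∀ j → Adj (node₂ j) (node₁ j)
  node₂→node₁ j = inj₂ (∈-++⁺ʳ _ (there (there (∈-++⁺ʳ _ (∈-tabulate⁺ j)))))

  size : m₀ + (2 + (n + n)) ≡ length TE + 1
  size = begin
    m₀ + N                    ≡⟨ cong (_+ N) treeSize₀ ⟩
    length TE₀ + 1 + N        ≡⟨ +-assoc (length TE₀) 1 N ⟩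
    length TE₀ + (1 + N)      ≡⟨ cong (length TE₀ +_) (+-comm 1 N) ⟩
    length TE₀ + (N + 1)      ≡⟨ +-assoc (length TE₀) N 1 ⟨
    length TE₀ + N + 1        ≡⟨ cong (_+ 1) length-TE ⟨
    length TE + 1             ∎
    where
    open ≡-Reasoning
    N = 2 + (n + n)
    new : length (homeEdges ++ pairEdges) ≡ n + n
    new = trans (length-++ homeEdges) (cong₂ _+_ (length-tabulate {n = n} _) (length-tabulate {n = n} _))
    length-TE : length TE ≡ length TE₀ + N
    length-TE = trans (length-++ (map _ TE₀)) (cong₂ _+_ (length-map _ TE₀) (cong (2 +_) new))

  bag : K → List V
  bag (old t)   = a ∷ b ∷ map orig (X t)
  bag leafA     = a ∷ a' ∷ []
  bag leafB     = b ∷ b' ∷ []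
  bag (node₁ j) = a ∷ b ∷ orig j ∷ gadget₁ j
  bag (node₂ j) = a ∷ orig j ∷ gadgets j

  data _∈ᵇ_ : V → K → Set where
    a∈old     : ∀ {t} → a ∈ᵇ old t
    b∈old     : ∀ {t} → b ∈ᵇ old t
    j∈old     : ∀ {t j} → j ∈ X t → orig j ∈ᵇ old t
    a∈leafA   : a ∈ᵇ leafA
    a'∈leafA  : a' ∈ᵇ leafA
    b∈leafB   : b ∈ᵇ leafB
    b'∈leafB  : b' ∈ᵇ leafB
    a∈node₁   : ∀ {j} → a ∈ᵇ node₁ j
    b∈node₁   : ∀ {j} → b ∈ᵇ node₁ j
    j∈node₁   : ∀ {j} → orig j ∈ᵇ node₁ j
    j1∈node₁  : ∀ {j} p → j1 j p ∈ᵇ node₁ j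
    a∈node₂   : ∀ {j} → a ∈ᵇ node₂ j
    j∈node₂   : ∀ {j} → orig j ∈ᵇ node₂ j
    j1∈node₂  : ∀ {j} p → j1 j p ∈ᵇ node₂ j
    j2∈node₂  : ∀ {j} q → j2 j q ∈ᵇ node₂ j

  ∈ᵇ⇒∈bag : ∀ {v s} → v ∈ᵇ s → v ∈ bag s
  ∈ᵇ⇒∈bag a∈old            = here refl
  ∈ᵇ⇒∈bag b∈old            = there (here refl)
  ∈ᵇ⇒∈bag (j∈old j∈t)      = there (there (∈-map⁺ orig j∈t))
  ∈ᵇ⇒∈bag a∈leafA          = here refl
  ∈ᵇ⇒∈bag a'∈leafA         = there (here refl)
  ∈ᵇ⇒∈bag b∈leafB          = here refl
  ∈ᵇ⇒∈bag b'∈leafB         = there (here refl)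
  ∈ᵇ⇒∈bag a∈node₁          = here refl
  ∈ᵇ⇒∈bag b∈node₁          = there (here refl)
  ∈ᵇ⇒∈bag j∈node₁          = there (there (here refl))
  ∈ᵇ⇒∈bag (j1∈node₁ p)     = there (there (there (∈-optional⁺ _ _ p)))
  ∈ᵇ⇒∈bag a∈node₂          = here refl
  ∈ᵇ⇒∈bag j∈node₂          = there (here refl)
  ∈ᵇ⇒∈bag (j1∈node₂ {j} p) = there (there (j1∈gadgets j p))
  ∈ᵇ⇒∈bag (j2∈node₂ {j} q) = there (there (j2∈gadgets j q))

  ∈bag⇒∈ᵇ : ∀ {v} s → v ∈ bag s → v ∈ᵇ s
  ∈bag⇒∈ᵇ (old t)   (here refl)         = a∈old
  ∈bag⇒∈ᵇ (old t)   (there (here refl)) = b∈old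
  ∈bag⇒∈ᵇ (old t)   (there (there v∈)) with ∈-map⁻ orig v∈
  ... | _ , j∈t , refl                   = j∈old j∈t
  ∈bag⇒∈ᵇ leafA     (here refl)         = a∈leafA
  ∈bag⇒∈ᵇ leafA     (there (here refl)) = a'∈leafA
  ∈bag⇒∈ᵇ leafB     (here refl)         = b∈leafB
  ∈bag⇒∈ᵇ leafB     (there (here refl)) = b'∈leafB
  ∈bag⇒∈ᵇ (node₁ j) (here refl)                 = a∈node₁
  ∈bag⇒∈ᵇ (node₁ j) (there (here refl))         = b∈node₁
  ∈bag⇒∈ᵇ (node₁ j) (there (there (here refl))) = j∈node₁
  ∈bag⇒∈ᵇ (node₁ j) (there (there (there v∈))) with ∈-optional⁻ _ _ v∈
  ... | p , refl                                 = j1∈node₁ p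
  ∈bag⇒∈ᵇ (node₂ j) (here refl)         = a∈node₂
  ∈bag⇒∈ᵇ (node₂ j) (there (here refl)) = j∈node₂
  ∈bag⇒∈ᵇ (node₂ j) (there (there v∈)) with ∈-gadgets⁻ j v∈
  ... | inj₁ (p , refl)                  = j1∈node₂ p
  ... | inj₂ (q , refl)                  = j2∈node₂ q

  Walkᵇ : V → K → K → Set
  Walkᵇ v = Walk Adj (v ∈ᵇ_)

  lift : ∀ {v} {Q : Fin m₀ → Set} → (∀ {t} → Q t → v ∈ᵇ old t) →
         ∀ {s t} → Walk TAdj₀ Q s t → Walkᵇ v (old s) (old t)
  lift = walk-map old old-adj

  a-to-root : ∀ {s} → a ∈ᵇ s → Walkᵇ a s (old root)
  a-to-root (a∈old {t})   = lift (λ _ → a∈old) (connected₀ t root)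
  a-to-root a∈leafA       = step a∈leafA leafA→root (here a∈old)
  a-to-root (a∈node₁ {j}) = step a∈node₁ (node₁→home j) (lift (λ _ → a∈old) (connected₀ (home j) root))
  a-to-root (a∈node₂ {j}) = step a∈node₂ (node₂→node₁ j) (a-to-root a∈node₁)

  b-to-root : ∀ {s} → b ∈ᵇ s → Walkᵇ b s (old root)
  b-to-root (b∈old {t})   = lift (λ _ → b∈old) (connected₀ t root)
  b-to-root b∈leafB       = step b∈leafB leafB→root (here b∈old)
  b-to-root (b∈node₁ {j}) = step b∈node₁ (node₁→home j) (lift (λ _ → b∈old) (connected₀ (home j) root))

  j-to-old : ∀ {j s} → orig j ∈ᵇ s → ∃[ t ] (j ∈ X t × Walkᵇ (orig j) s (old t))
  j-to-old (j∈old j∈t)     = _ , j∈t , here (j∈old j∈t)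
  j-to-old (j∈node₁ {j})   = home j , j∈home j , step j∈node₁ (node₁→home j) (here (j∈old (j∈home j)))
  j-to-old (j∈node₂ {j})   = let (t , j∈t , walk) = j-to-old j∈node₁ in
                             t , j∈t , step j∈node₂ (node₂→node₁ j) walk

  j1-to-node₁ : ∀ {j p s} → j1 j p ∈ᵇ s → Walkᵇ (j1 j p) s (node₁ j)
  j1-to-node₁ (j1∈node₁ p)     = here (j1∈node₁ p)
  j1-to-node₁ (j1∈node₂ {j} p) = step (j1∈node₂ p) (node₂→node₁ j) (here (j1∈node₁ p))

  through : ∀ {P : K → Set} {s t r} → Walk Adj P s r → Walk Adj P t r → Walk Adj P s t
  through p q = p ◅◅ walk-reverse Adj-sym q

  subtreeᵇ : ∀ {v s t} → v ∈ᵇ s → v ∈ᵇ t → Walkᵇ v s t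
  subtreeᵇ {a}        p q = through (a-to-root p) (a-to-root q)
  subtreeᵇ {b}        p q = through (b-to-root p) (b-to-root q)
  subtreeᵇ {j1 _ _}   p q = through (j1-to-node₁ p) (j1-to-node₁ q)
  subtreeᵇ {orig j}   p q with j-to-old p | j-to-old q
  ... | s , j∈s , walkₛ | t , j∈t , walkₜ =
    walkₛ ◅◅ lift j∈old (subtree₀ j s t j∈s j∈t) ◅◅ walk-reverse Adj-sym walkₜ
  subtreeᵇ a'∈leafA     a'∈leafA     = here a'∈leafA
  subtreeᵇ b'∈leafB     b'∈leafB     = here b'∈leafB
  subtreeᵇ (j2∈node₂ q) (j2∈node₂ _) = here (j2∈node₂ q)

  old-to-root : ∀ t → Walk Adj (λ _ → ⊤) (old t) (old root)
  old-to-root t = walk-map old old-adj (λ _ → tt) (connected₀ t root)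

  to-root : ∀ s → Walk Adj (λ _ → ⊤) s (old root)
  to-root (old t)   = old-to-root t
  to-root leafA     = step tt leafA→root (here tt)
  to-root leafB     = step tt leafB→root (here tt)
  to-root (node₁ j) = step tt (node₁→home j) (old-to-root (home j))
  to-root (node₂ j) = step tt (node₂→node₁ j) (step tt (node₁→home j) (old-to-root (home j)))

  coverVᵇ : ∀ v → ∃[ s ] (v ∈ᵇ s)
  coverVᵇ (orig j) = old (home j) , j∈old (j∈home j)
  coverVᵇ a        = leafA , a∈leafA
  coverVᵇ a'       = leafA , a'∈leafA
  coverVᵇ b        = leafB , b∈leafB
  coverVᵇ b'       = leafB , b'∈leafB
  coverVᵇ (j1 j p) = node₁ j , j1∈node₁ p
  coverVᵇ (j2 j q) = node₂ j , j2∈node₂ q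

  coverEᵇ : ∀ {u v} → GE0 H k χ u v → ∃[ s ] (u ∈ᵇ s × v ∈ᵇ s)
  coverEᵇ (eH {u} {v} e)  = let (t , u∈t , v∈t) = coverE₀ u v e in old t , j∈old u∈t , j∈old v∈t
  coverEᵇ eaa'            = leafA , a∈leafA , a'∈leafA
  coverEᵇ ebb'            = leafB , b∈leafB , b'∈leafB
  coverEᵇ eab             = old root , a∈old , b∈old
  coverEᵇ (ej-j1 j p)     = node₁ j , j∈node₁ , j1∈node₁ p
  coverEᵇ (ej-j2 j q)     = node₂ j , j∈node₂ , j2∈node₂ q
  coverEᵇ (ej1-j2 j p q)  = node₂ j , j1∈node₂ p , j2∈node₂ q
  coverEᵇ (ea-j j _)      = node₁ j , a∈node₁ , j∈node₁
  coverEᵇ (eb-j j _)      = node₁ j , b∈node₁ , j∈node₁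
  coverEᵇ (ea-j2 j q)     = node₂ j , a∈node₂ , j2∈node₂ q
  coverEᵇ (eb-j1 j p)     = node₁ j , b∈node₁ , j1∈node₁ p

  4≤w+3 : 1 ≤ w → 4 ≤ suc (w + 2)
  4≤w+3 1≤w = subst (4 ≤_) (cong suc (+-comm 2 w)) (s≤s (s≤s (s≤s 1≤w)))

  bag-width : 1 ≤ w → ∀ s → length (bag s) ≤ suc (w + 2)
  bag-width _   (old t)   = subst (length (bag (old t)) ≤_) (cong suc (+-comm 2 w))
    (s≤s (s≤s (≤-trans (≤-reflexive (length-map orig (X t))) (TreeDecomposition.bagWidth D t))))
  bag-width 1≤w leafA     = ≤-trans (s≤s (s≤s z≤n)) (4≤w+3 1≤w)
  bag-width 1≤w leafB     = ≤-trans (s≤s (s≤s z≤n)) (4≤w+3 1≤w)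
  bag-width 1≤w (node₁ j) = ≤-trans (s≤s (s≤s (s≤s (length-optional (has1 k (χ j)) (j1 j))))) (4≤w+3 1≤w)
  bag-width 1≤w (node₂ j) = ≤-trans (s≤s (s≤s (length-gadgets {k = k} {χ} j))) (4≤w+3 1≤w)

  multiTree : 1 ≤ w → MultiTreeDecomposition (conflictGraph H k χ) K (w + 2)
  multiTree 1≤w = record
    { m             = m₀ + (2 + (n + n))
    ; index         = node↔Fin
    ; TE            = TE
    ; treeSize      = size
    ; treeConnected = λ s t → through (to-root s) (to-root t)
    ; bag           = bag
    ; bagWidth      = bag-width 1≤w
    ; coverV        = λ v → map₂ ∈ᵇ⇒∈bag (coverVᵇ v)
    ; coverE        = λ where
        u v (inj₁ e) → let (s , u∈s , v∈s) = coverEᵇ e in s , ∈ᵇ⇒∈bag u∈s , ∈ᵇ⇒∈bag v∈s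
        u v (inj₂ e) → let (s , v∈s , u∈s) = coverEᵇ e in s , ∈ᵇ⇒∈bag u∈s , ∈ᵇ⇒∈bag v∈s
    ; subtree       = λ v s t v∈s v∈t →
        walk-map (λ r → r) (λ r → r) ∈ᵇ⇒∈bag (subtreeᵇ (∈bag⇒∈ᵇ s v∈s) (∈bag⇒∈ᵇ t v∈t))
    }

module PathConstruction {n} .{{_ : NonZero n}} (H : SimpleGraph n) (k : ℕ) (χ : Fin n → Maybe ℕ) {w : ℕ}
                        (D : MultiPathDecomposition (toGraph H) w) where

  open MultiPathDecomposition D using () renaming
    (m to m₀; bag to X; bagWidth to bagWidth₀; coverV to coverV₀; coverE to coverE₀; interval to interval₀)

  V : Set
  V = GV n k χ

  home : Fin n → ℕ
  home j = proj₁ (coverV₀ j)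

  home≤m₀ : ∀ j → home j ≤ m₀
  home≤m₀ j = proj₁ (proj₂ (coverV₀ j))

  j∈home : ∀ j → j ∈ X (home j)
  j∈home j = proj₂ (proj₂ (coverV₀ j))

  code : Fin n → ℕ
  code j = toℕ j + home j * n

  M : ℕ
  M = suc m₀ * n

  code<M : ∀ j → code j < M
  code<M j = r+q*n<s*n (home j) j (s≤s (home≤m₀ j))

  gadgetsAt : ℕ → Fin n → List V
  gadgetsAt x j with code j ≟ℕ x
  ... | yes _ = gadgets j
  ... | no  _ = []

  -- Position x + 1 holds copy x mod n of the old bag X (x / n).
  bag : ℕ → List V
  bag zero    = a ∷ a' ∷ b ∷ b' ∷ []
  bag (suc x) = a ∷ b ∷ map orig (X (x / n)) ++ gadgetsAt x (x mod n)

  ∈-gadgetsAt⁻ : ∀ {v x} j → v ∈ gadgetsAt x j → code j ≡ x × v ∈ gadgets j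
  ∈-gadgetsAt⁻ {x = x} j v∈ with code j ≟ℕ x
  ... | yes code≡x = code≡x , v∈

  ∈-gadgetsAt⁺ : ∀ {v} j → v ∈ gadgets j → v ∈ gadgetsAt (code j) (code j mod n)
  ∈-gadgetsAt⁺ {v} j v∈ = subst (λ i → v ∈ gadgetsAt (code j) i) (sym ([r+q*n]mod[n]≡r (home j) j)) at-code
    where
    at-code : v ∈ gadgetsAt (code j) j
    at-code with code j ≟ℕ code j
    ... | yes _   = v∈
    ... | no  ≢   = ⊥-elim (≢ refl)

  length-gadgetsAt : ∀ x j → length (gadgetsAt x j) ≤ 2
  length-gadgetsAt x j with code j ≟ℕ x
  ... | yes _ = length-gadgets {k = k} {χ} j
  ... | no  _ = z≤n

  data _∈ᵇ_ : V → ℕ → Set where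
    a∈   : ∀ {x} → a ∈ᵇ x
    b∈   : ∀ {x} → b ∈ᵇ x
    a'∈  : a' ∈ᵇ 0
    b'∈  : b' ∈ᵇ 0
    j∈   : ∀ {j x} → j ∈ X (x / n) → orig j ∈ᵇ suc x
    j1∈  : ∀ {j} p → j1 j p ∈ᵇ suc (code j)
    j2∈  : ∀ {j} q → j2 j q ∈ᵇ suc (code j)

  ∈ᵇ⇒∈bag : ∀ {v x} → v ∈ᵇ x → v ∈ bag x
  ∈ᵇ⇒∈bag (a∈ {zero})  = here refl
  ∈ᵇ⇒∈bag (a∈ {suc _}) = here refl
  ∈ᵇ⇒∈bag (b∈ {zero})  = there (there (here refl))
  ∈ᵇ⇒∈bag (b∈ {suc _}) = there (here refl)
  ∈ᵇ⇒∈bag a'∈          = there (here refl)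
  ∈ᵇ⇒∈bag b'∈          = there (there (there (here refl)))
  ∈ᵇ⇒∈bag (j∈ j∈X)     = there (there (∈-++⁺ˡ (∈-map⁺ orig j∈X)))
  ∈ᵇ⇒∈bag (j1∈ {j} p)  = there (there (∈-++⁺ʳ _ (∈-gadgetsAt⁺ j (j1∈gadgets j p))))
  ∈ᵇ⇒∈bag (j2∈ {j} q)  = there (there (∈-++⁺ʳ _ (∈-gadgetsAt⁺ j (j2∈gadgets j q))))

  ∈gadgets⇒∈ᵇ : ∀ {v x} j → code j ≡ x → v ∈ gadgets j → v ∈ᵇ suc x
  ∈gadgets⇒∈ᵇ j refl v∈ with ∈-gadgets⁻ j v∈
  ... | inj₁ (p , refl) = j1∈ p
  ... | inj₂ (q , refl) = j2∈ q

  ∈bag⇒∈ᵇ : ∀ {v} x → v ∈ bag x → v ∈ᵇ x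
  ∈bag⇒∈ᵇ zero    (here refl)                         = a∈
  ∈bag⇒∈ᵇ zero    (there (here refl))                 = a'∈
  ∈bag⇒∈ᵇ zero    (there (there (here refl)))         = b∈
  ∈bag⇒∈ᵇ zero    (there (there (there (here refl)))) = b'∈
  ∈bag⇒∈ᵇ (suc x) (here refl)                         = a∈
  ∈bag⇒∈ᵇ (suc x) (there (here refl))                 = b∈
  ∈bag⇒∈ᵇ (suc x) (there (there v∈)) with ∈-++⁻ (map orig (X (x / n))) v∈
  ... | inj₁ v∈X with ∈-map⁻ orig v∈X
  ...   | _ , j∈X , refl = j∈ j∈X
  ∈bag⇒∈ᵇ (suc x) (there (there v∈)) | inj₂ v∈G = uncurry (∈gadgets⇒∈ᵇ _) (∈-gadgetsAt⁻ (x mod n) v∈G)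

  intervalᵇ : ∀ {v x y z} → x ≤ y → y ≤ z → v ∈ᵇ x → v ∈ᵇ z → v ∈ᵇ y
  intervalᵇ _ _ a∈ _ = a∈
  intervalᵇ _ _ b∈ _ = b∈
  intervalᵇ _ y≤0 a'∈ a'∈ with n≤0⇒n≡0 y≤0
  ... | refl = a'∈
  intervalᵇ _ y≤0 b'∈ b'∈ with n≤0⇒n≡0 y≤0
  ... | refl = b'∈
  intervalᵇ (s≤s x≤y) y≤z (j∈ {j} j∈x) (j∈ j∈z) =
    j∈ (interval₀ j (/-monoˡ-≤ n x≤y) (/-monoˡ-≤ n (s≤s⁻¹ y≤z)) j∈x j∈z)
  intervalᵇ x≤y y≤z (j1∈ p) (j1∈ _) with ≤-antisym y≤z x≤y
  ... | refl = j1∈ p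
  intervalᵇ x≤y y≤z (j2∈ q) (j2∈ _) with ≤-antisym y≤z x≤y
  ... | refl = j2∈ q

  j∈code : ∀ j → orig j ∈ᵇ suc (code j)
  j∈code j = j∈ (subst (λ q → j ∈ X q) (sym ([r+q*n]/n≡q (home j) j)) (j∈home j))

  j∈first-copy : ∀ {j x} → j ∈ X x → orig j ∈ᵇ suc (x * n)
  j∈first-copy {j} {x} j∈x = j∈ (subst (λ q → j ∈ X q) (sym (m*n/n≡m x n)) j∈x)

  coverVᵇ : ∀ v → ∃[ x ] (x ≤ M × v ∈ᵇ x)
  coverVᵇ (orig j) = suc (code j) , code<M j , j∈code j
  coverVᵇ a        = 0 , z≤n , a∈
  coverVᵇ a'       = 0 , z≤n , a'∈
  coverVᵇ b        = 0 , z≤n , b∈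
  coverVᵇ b'       = 0 , z≤n , b'∈
  coverVᵇ (j1 j p) = suc (code j) , code<M j , j1∈ p
  coverVᵇ (j2 j q) = suc (code j) , code<M j , j2∈ q

  coverEᵇ : ∀ {u v} → GE0 H k χ u v → ∃[ x ] (x ≤ M × u ∈ᵇ x × v ∈ᵇ x)
  coverEᵇ (eH {u} {v} e) =
    let (x , x≤m₀ , u∈x , v∈x) = coverE₀ u v e in
    suc (x * n) , *-monoˡ-< n (s≤s x≤m₀) , j∈first-copy u∈x , j∈first-copy v∈x
  coverEᵇ eaa'           = 0 , z≤n , a∈ , a'∈
  coverEᵇ ebb'           = 0 , z≤n , b∈ , b'∈
  coverEᵇ eab            = 0 , z≤n , a∈ , b∈
  coverEᵇ (ej-j1 j p)    = suc (code j) , code<M j , j∈code j , j1∈ p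
  coverEᵇ (ej-j2 j q)    = suc (code j) , code<M j , j∈code j , j2∈ q
  coverEᵇ (ej1-j2 j p q) = suc (code j) , code<M j , j1∈ p , j2∈ q
  coverEᵇ (ea-j j _)     = suc (code j) , code<M j , a∈ , j∈code j
  coverEᵇ (eb-j j _)     = suc (code j) , code<M j , b∈ , j∈code j
  coverEᵇ (ea-j2 j q)    = suc (code j) , code<M j , a∈ , j2∈ q
  coverEᵇ (eb-j1 j p)    = suc (code j) , code<M j , b∈ , j1∈ p

  bag-width : ∀ x → length (bag x) ≤ suc (w + 4)
  bag-width zero    = m≤n⇒m≤1+n (m≤n+m 4 w)
  bag-width (suc x) = subst (length (bag (suc x)) ≤_) w+5 (s≤s (s≤s (begin
    length (olds ++ news)             ≡⟨ length-++ olds ⟩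
    length olds + length news         ≡⟨ cong (_+ length news) (length-map orig (X (x / n))) ⟩
    length (X (x / n)) + length news  ≤⟨ +-mono-≤ (bagWidth₀ (x / n)) (length-gadgetsAt x (x mod n)) ⟩
    suc w + 2                         ∎)))
    where
    open ≤-Reasoning
    olds = map orig (X (x / n))
    news = gadgetsAt x (x mod n)
    w+5 : 2 + (suc w + 2) ≡ suc (w + 4)
    w+5 = cong suc (sym (trans (+-suc w 3) (cong suc (+-suc w 2))))

  multiPath : MultiPathDecomposition (conflictGraph H k χ) (w + 4)
  multiPath = record
    { m        = M
    ; bag      = bag
    ; bagWidth = bag-width
    ; coverV   = λ v → let (x , x≤M , v∈x) = coverVᵇ v in x , x≤M , ∈ᵇ⇒∈bag v∈x
    ; coverE   = λ where
        u v (inj₁ e) → let (x , x≤M , u∈x , v∈x) = coverEᵇ e in x , x≤M , ∈ᵇ⇒∈bag u∈x , ∈ᵇ⇒∈bag v∈x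
        u v (inj₂ e) → let (x , x≤M , v∈x , u∈x) = coverEᵇ e in x , x≤M , ∈ᵇ⇒∈bag u∈x , ∈ᵇ⇒∈bag v∈x
    ; interval = λ v {x} {y} {z} x≤y y≤z v∈x v∈z →
        ∈ᵇ⇒∈bag (intervalᵇ x≤y y≤z (∈bag⇒∈ᵇ x v∈x) (∈bag⇒∈ᵇ z v∈z))
    }

lemma8 : ∀ {n} (H : SimpleGraph n) (k : ℕ) (χ : Fin n → Maybe ℕ) →
    ValidPrecoloring H k χ → HasEdge H →
    (∀ w → TwLe (toGraph H) w → TwLe (conflictGraph H k χ) (w + 2)) ×
    (∀ w → PwLe (toGraph H) w → PwLe (conflictGraph H k χ) (w + 4))
-- The width bounds hold whether or not the precoloring is valid.
lemma8 {zero}  H k χ _ (() , _)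
lemma8 {suc n} H k χ _ edge =
  (λ w D → toTreeDecomposition _≟ⱽ_ (TreeConstruction.multiTree H k χ D (edge⇒1≤width H edge D))) ,
  (λ w D → toPathDecomposition _≟ⱽ_ (PathConstruction.multiPath H k χ (fromPathDecomposition D)))
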